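{- Let $k$ divide $n$ and let $X_k$ be the set of partitions of $\{1,\dots,n\}$ into $k$ (unordered) cells each of size $n/k$. If $\pi \in S_n$ has $c$ cycles, then the number of partitions in $X_k$ preserved by $\pi$ (i.e. fixed points of $\pi$ in its natural action on $X_k$) is at most $k^c$.
   Context: $c$ counts all cycles of $\pi$, including fixed points. -}

module Defs where

open import Data.Bool using (Bool; true; false; _∧_; _∨_; not)
open import Data.Nat using (ℕ; zero; suc; _≤ᵇ_)
open import Data.Fin using (Fin; toℕ)
open import Data.Fin.Permutation using (Permutation′; _⟨$⟩ʳ_)
open import Data.Product using (_×_; ∃₂)
open import Data.Vec using (allFin; countᵇ)
import Data.List as L
open import Relation.Binary.PropositionalEquality using (_≡_; _≢_)

iter : {A : Set} → (A → A) → ℕ → A → A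
iter f zero    x = x
iter f (suc t) x = f (iter f t x)

allL : {A : Set} → (A → Bool) → L.List A → Bool
allL p L.[]       = true
allL p (x L.∷ xs) = p x ∧ allL p xs

allᶠ : (n : ℕ) → (Fin n → Bool) → Bool
allᶠ n p = allL p (L.allFin n)

isCycleMin : {n : ℕ} → Permutation′ n → Fin n → Bool
isCycleMin {n} π i =
  allL (λ t → toℕ i ≤ᵇ toℕ (iter (π ⟨$⟩ʳ_) t i)) (L.upTo n)

-- number of cycles of π (fixed points included): one per cycle, counted
-- via its least element
cycles : {n : ℕ} → Permutation′ n → ℕ
cycles {n} π = countᵇ (isCycleMin π) (allFin n)

-- A set partition of Fin n is represented by its equivalence relation
-- (as a Boolean-valued relation R i j = "i and j lie in the same cell").
IsEquivalence : (n : ℕ) → (Fin n → Fin n → Bool) → Set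
IsEquivalence n R =
  (∀ i → R i i ≡ true) ×
  (∀ i j → R i j ≡ R j i) ×
  (∀ i j l → R i j ≡ true → R j l ≡ true → R i l ≡ true)

isCellMin : {n : ℕ} → (Fin n → Fin n → Bool) → Fin n → Bool
isCellMin {n} R i = allᶠ n (λ j → not (R i j) ∨ (toℕ i ≤ᵇ toℕ j))

numCells : {n : ℕ} → (Fin n → Fin n → Bool) → ℕ
numCells {n} R = countᵇ (isCellMin R) (allFin n)

cellSize : {n : ℕ} → (Fin n → Fin n → Bool) → Fin n → ℕ
cellSize {n} R i = countᵇ (R i) (allFin n)

-- R ∈ X_k : a partition of Fin n into k cells, each of size s (= n/k)
InX : (n k s : ℕ) → (Fin n → Fin n → Bool) → Set
InX n k s R = IsEquivalence n R × numCells R ≡ k × (∀ i → cellSize R i ≡ s)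

Preserves : {n : ℕ} → Permutation′ n → (Fin n → Fin n → Bool) → Set
Preserves π R = ∀ i j → R (π ⟨$⟩ʳ i) (π ⟨$⟩ʳ j) ≡ R i j

Distinct : {n : ℕ} → (Fin n → Fin n → Bool) → (Fin n → Fin n → Bool) → Set
Distinct R S = ∃₂ λ i j → R i j ≢ S i j

-- Go through the cycles of π in the order of their least elements. Let U be the union of the
-- cycles already treated and e the least element of the next cycle C. A π-invariant partition
-- with at most k cells is determined on U ∪ C by its restriction to U together with one number
-- below k: if the cell of e meets U, the index of that cell among the cells meeting U;
-- otherwise (number of cells meeting U) + d − 1, where d > 0 is least with π^d e in the cell
-- of e. In the second case e, π e, …, π^(d−1) e lie in d further distinct cells, and by
-- invariance π^a e and π^b e share a cell exactly when d divides their distance on C.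
-- So each cycle multiplies the number of possibilities by at most k.

module Submission where

open import Defs
open import Data.Bool using (Bool; true; false; _∧_; _∨_; not) renaming (_≟_ to _≟ᵇ_)
open import Data.Bool.Properties using (∧-conicalˡ; ∧-conicalʳ; ∧-identityʳ; ∧-zeroʳ; T-≡)
open import Data.Nat using (ℕ; zero; suc; _+_; _*_; _∸_; _≤_; _<_; _^_; z≤n; s≤s; z<s; s<s; _≤ᵇ_; _<ᵇ_; _≡ᵇ_)
open import Data.Nat.Properties
open import Data.Nat.Divisibility using (_∣_)
open import Data.Nat.DivMod using (_%_; _/_; m≡m%n+[m/n]*n; m%n<n)
open import Data.Fin using (Fin; toℕ; fromℕ<) renaming (zero to fz; suc to fs; _≟_ to _≟ᶠ_)
open import Data.Fin.Properties using (toℕ-injective; toℕ<n; toℕ-fromℕ<; pigeonhole) renaming (suc-injective to fs-injective)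
open import Data.Fin.Permutation using (Permutation′; _⟨$⟩ʳ_; _⟨$⟩ˡ_; inverseˡ)
open import Data.List using (List; []; _∷_; length; applyUpTo; upTo; _++_; filter)
import Data.List as L
open import Data.List.Properties using (filter-all; filter-none; filter-accept; filter-reject; length-++; length-applyUpTo; length-map)
import Data.Vec as V
open import Data.List.Relation.Unary.All as All using (All; []; _∷_)
import Data.List.Relation.Unary.All.Properties as All
open import Data.List.Relation.Unary.AllPairs as AllPairs using (AllPairs; []; _∷_)
import Data.List.Relation.Unary.AllPairs.Properties as AllPairs
open import Data.Product using (_×_; _,_; proj₁; proj₂; Σ; ∃)
open import Data.Sum using (_⊎_; inj₁; inj₂)
open import Function using (_∘_; id; Equivalence)
open import Relation.Nullary using (¬_; yes; no; does; contradiction)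
open import Relation.Nullary.Decidable using (dec-true; dec-false)
open import Relation.Unary using (Decidable)
open import Relation.Binary using (tri<; tri≈; tri>)
open import Relation.Binary.PropositionalEquality

Rel : ℕ → Set
Rel n = Fin n → Fin n → Bool

true≢false : true ≢ false
true≢false ()

≤ᵇ-true⇒≤ : ∀ {m n} → (m ≤ᵇ n) ≡ true → m ≤ n
≤ᵇ-true⇒≤ {m} {n} h = ≤ᵇ⇒≤ m n (Equivalence.from T-≡ h)

≤⇒≤ᵇ-true : ∀ {m n} → m ≤ n → (m ≤ᵇ n) ≡ true
≤⇒≤ᵇ-true m≤n = Equivalence.to T-≡ (≤⇒≤ᵇ m≤n)

≤ᵇ-false⇒> : ∀ {m n} → (m ≤ᵇ n) ≡ false → n < m
≤ᵇ-false⇒> h = ≰⇒> (λ m≤n → true≢false (trans (sym (≤⇒≤ᵇ-true m≤n)) h))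

>⇒≤ᵇ-false : ∀ {m n} → n < m → (m ≤ᵇ n) ≡ false
>⇒≤ᵇ-false {m} {n} n<m with m ≤ᵇ n in eq
... | false = refl
... | true  = contradiction (≤ᵇ-true⇒≤ eq) (<⇒≱ n<m)

<ᵇ-true⇒< : ∀ {m n} → (m <ᵇ n) ≡ true → m < n
<ᵇ-true⇒< {m} = ≤ᵇ-true⇒≤ {suc m}

<⇒<ᵇ-true : ∀ {m n} → m < n → (m <ᵇ n) ≡ true
<⇒<ᵇ-true {m} = ≤⇒≤ᵇ-true {suc m}

not-true⇒false : ∀ {b} → not b ≡ true → b ≡ false
not-true⇒false {false} _ = refl

n<ᵇn-false : ∀ n → (n <ᵇ n) ≡ false
n<ᵇn-false n = >⇒≤ᵇ-false {suc n} (n<1+n n)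

allL-applyUpTo-false⇒ : ∀ {A : Set} (p : A → Bool) (f : ℕ → A) n →
                        allL p (applyUpTo f n) ≡ false → ∃ λ t → t < n × p (f t) ≡ false
allL-applyUpTo-false⇒ p f (suc n) h with p (f 0) in eq
... | false = 0 , z<s , eq
... | true with t , t<n , pt ← allL-applyUpTo-false⇒ p (f ∘ suc) n h = suc t , s<s t<n , pt

allL-applyUpTo-false : ∀ {A : Set} (p : A → Bool) (f : ℕ → A) {n t} →
                       t < n → p (f t) ≡ false → allL p (applyUpTo f n) ≡ false
allL-applyUpTo-false p f {suc n} {zero} _ pt rewrite pt = refl
allL-applyUpTo-false p f {suc n} {suc t} (s<s t<n) pt with p (f 0)
... | false = refl
... | true  = allL-applyUpTo-false p (f ∘ suc) t<n pt

allL-cong : ∀ {A : Set} {p q : A → Bool} → (∀ x → p x ≡ q x) → ∀ xs → allL p xs ≡ allL q xs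
allL-cong p≗q []       = refl
allL-cong p≗q (x ∷ xs) = cong₂ _∧_ (p≗q x) (allL-cong p≗q xs)

allL-const-true : ∀ {A : Set} (xs : List A) → allL (λ _ → true) xs ≡ true
allL-const-true []       = refl
allL-const-true (_ ∷ xs) = allL-const-true xs

allL-tabulate-true⇒ : ∀ {A : Set} {n} (p : A → Bool) (f : Fin n → A) →
                      allL p (L.tabulate f) ≡ true → ∀ i → p (f i) ≡ true
allL-tabulate-true⇒ {n = suc n} p f h fz     = ∧-conicalˡ _ _ h
allL-tabulate-true⇒ {n = suc n} p f h (fs i) = allL-tabulate-true⇒ p (f ∘ fs) (∧-conicalʳ _ _ h) i

allL-tabulate-true : ∀ {A : Set} {n} (p : A → Bool) (f : Fin n → A) →
                     (∀ i → p (f i) ≡ true) → allL p (L.tabulate f) ≡ true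
allL-tabulate-true {n = zero}  p f h = refl
allL-tabulate-true {n = suc n} p f h rewrite h fz = allL-tabulate-true p (f ∘ fs) (h ∘ fs)

allᶠ-true⇒ : ∀ {n} (p : Fin n → Bool) → allᶠ n p ≡ true → ∀ i → p i ≡ true
allᶠ-true⇒ p = allL-tabulate-true⇒ p id

allᶠ-true : ∀ {n} (p : Fin n → Bool) → (∀ i → p i ≡ true) → allᶠ n p ≡ true
allᶠ-true p = allL-tabulate-true p id

AllPairs-zipWith-All : ∀ {A : Set} {P : A → Set} {R S : A → A → Set} →
                       (∀ {x y} → P x → P y → R x y → S x y) →
                       ∀ {xs} → All P xs → AllPairs R xs → AllPairs S xs
AllPairs-zipWith-All f []         []         = []
AllPairs-zipWith-All f (px ∷ pxs) (rx ∷ rxs) =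
  All.zipWith (λ (py , r) → f px py r) (pxs , rx) ∷ AllPairs-zipWith-All f pxs rxs

-- Counting in Fin n

count : ∀ n → (Fin n → Bool) → ℕ
count zero    P = 0
count (suc n) P with P fz
... | true  = suc (count n (P ∘ fs))
... | false = count n (P ∘ fs)

countᵇ-tabulate : ∀ {A : Set} {n} (p : A → Bool) (f : Fin n → A) →
                  V.countᵇ p (V.tabulate f) ≡ count n (p ∘ f)
countᵇ-tabulate {n = zero}  p f = refl
countᵇ-tabulate {n = suc n} p f with p (f fz)
... | true  = cong suc (countᵇ-tabulate p (f ∘ fs))
... | false = countᵇ-tabulate p (f ∘ fs)

countᵇ-allFin : ∀ {n} (P : Fin n → Bool) → V.countᵇ P (V.allFin n) ≡ count n P
countᵇ-allFin P = countᵇ-tabulate P id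

count-cong : ∀ {n} {P Q : Fin n → Bool} → (∀ i → P i ≡ Q i) → count n P ≡ count n Q
count-cong {zero}          P≗Q = refl
count-cong {suc n} {P} {Q} P≗Q with P fz | Q fz | P≗Q fz
... | true  | .true  | refl = cong suc (count-cong (P≗Q ∘ fs))
... | false | .false | refl = count-cong (P≗Q ∘ fs)

count-false : ∀ {n} {P : Fin n → Bool} → (∀ i → P i ≡ false) → count n P ≡ 0
count-false {zero}      _ = refl
count-false {suc n} {P} none with P fz | none fz
... | false | refl = count-false (none ∘ fs)

count-mono : ∀ {n} {P Q : Fin n → Bool} → (∀ i → P i ≡ true → Q i ≡ true) →
             count n P ≤ count n Q
count-mono {zero}          P⊆Q = z≤n
count-mono {suc n} {P} {Q} P⊆Q with P fz in p0 | Q fz in q0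
... | true  | true  = s≤s (count-mono (P⊆Q ∘ fs))
... | false | true  = m≤n⇒m≤1+n (count-mono (P⊆Q ∘ fs))
... | false | false = count-mono (P⊆Q ∘ fs)
... | true  | false = contradiction (trans (sym (P⊆Q fz p0)) q0) true≢false

count-mono-< : ∀ {n} {P Q : Fin n → Bool} → (∀ i → P i ≡ true → Q i ≡ true) →
               ∀ j → P j ≡ false → Q j ≡ true → count n P < count n Q
count-mono-< {suc n} {P} {Q} P⊆Q fz pj qj rewrite pj | qj = s≤s (count-mono (P⊆Q ∘ fs))
count-mono-< {suc n} {P} {Q} P⊆Q (fs j) pj qj with P fz in p0 | Q fz in q0
... | true  | true  = s<s (count-mono-< (P⊆Q ∘ fs) j pj qj)
... | false | true  = m<n⇒m<1+n (count-mono-< (P⊆Q ∘ fs) j pj qj)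
... | false | false = count-mono-< (P⊆Q ∘ fs) j pj qj
... | true  | false = contradiction (trans (sym (P⊆Q fz p0)) q0) true≢false

count-except : ∀ {n} {P Q : Fin n → Bool} (e : Fin n) → (∀ i → i ≢ e → P i ≡ Q i) →
               P e ≡ true → Q e ≡ false → count n P ≡ suc (count n Q)
count-except {suc n} {P} {Q} fz P≗Q pe qe rewrite pe | qe =
  cong suc (count-cong (λ i → P≗Q (fs i) λ ()))
count-except {suc n} {P} {Q} (fs e) P≗Q pe qe with P fz | Q fz | P≗Q fz (λ ())
... | true  | .true  | refl = cong suc (count-except e (λ i i≢e → P≗Q (fs i) (i≢e ∘ fs-injective)) pe qe)
... | false | .false | refl = count-except e (λ i i≢e → P≗Q (fs i) (i≢e ∘ fs-injective)) pe qe

rank : ∀ {n} → (Fin n → Bool) → Fin n → ℕ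
rank {n} P y = count n (λ z → (toℕ z <ᵇ toℕ y) ∧ P z)

rank<count : ∀ {n} (P : Fin n → Bool) {y} → P y ≡ true → rank P y < count n P
rank<count P {y} py =
  count-mono-< (λ i → ∧-conicalʳ _ _) y (cong (_∧ P y) (n<ᵇn-false (toℕ y))) py

rank-mono-< : ∀ {n} (P : Fin n → Bool) {y y'} → toℕ y < toℕ y' → P y ≡ true → rank P y < rank P y'
rank-mono-< P {y} {y'} y<y' py =
  count-mono-< below y (cong (_∧ P y) (n<ᵇn-false (toℕ y))) (cong₂ _∧_ (<⇒<ᵇ-true y<y') py)
  where
  below : ∀ z → ((toℕ z <ᵇ toℕ y) ∧ P z) ≡ true → ((toℕ z <ᵇ toℕ y') ∧ P z) ≡ true
  below z h = cong₂ _∧_ (<⇒<ᵇ-true (<-trans (<ᵇ-true⇒< (∧-conicalˡ _ _ h)) y<y')) (∧-conicalʳ _ _ h)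

rank-injective : ∀ {n} (P : Fin n → Bool) {y y'} → P y ≡ true → P y' ≡ true →
                 rank P y ≡ rank P y' → y ≡ y'
rank-injective P {y} {y'} py py' eq with <-cmp (toℕ y) (toℕ y')
... | tri< y<y' _ _ = contradiction eq (<⇒≢ (rank-mono-< P y<y' py))
... | tri≈ _ y≡y' _ = toℕ-injective y≡y'
... | tri> _ _ y>y' = contradiction (sym eq) (<⇒≢ (rank-mono-< P y>y' py'))

distinct⇒length≤count : ∀ {n} (P : Fin n → Bool) {ys} → AllPairs _≢_ ys →
                        All (λ y → P y ≡ true) ys → length ys ≤ count n P
distinct⇒length≤count P []                  []         = z≤n
distinct⇒length≤count P {y ∷ ys} (y∉ys ∷ u) (py ∷ pys) = begin
  suc (length ys)       ≤⟨ s≤s (distinct⇒length≤count P-y u (All.zipWith P-y-holds (y∉ys , pys))) ⟩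
  suc (count _ P-y)     ≡⟨ sym (count-except y (λ z → P-y-agrees) py P-y-y) ⟩
  count _ P             ∎
  where
  open ≤-Reasoning
  P-y : Fin _ → Bool
  P-y z = P z ∧ not (does (z ≟ᶠ y))
  P-y-agrees : ∀ {z} → z ≢ y → P z ≡ P-y z
  P-y-agrees {z} z≢y = sym (trans (cong (λ b → P z ∧ not b) (dec-false (z ≟ᶠ y) z≢y)) (∧-identityʳ (P z)))
  P-y-y : P-y y ≡ false
  P-y-y = trans (cong (λ b → P y ∧ not b) (dec-true (y ≟ᶠ y) refl)) (∧-zeroʳ (P y))
  P-y-holds : ∀ {z} → y ≢ z × P z ≡ true → P-y z ≡ true
  P-y-holds (y≢z , pz) = trans (sym (P-y-agrees (y≢z ∘ sym))) pz

satisfiers : ∀ {n} → (Fin n → Bool) → List (Fin n)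
satisfiers {n} P = filter (λ i → P i ≟ᵇ true) (L.allFin n)

length-filter-tabulate : ∀ {A : Set} {n} (p : A → Bool) (f : Fin n → A) →
                         length (filter (λ x → p x ≟ᵇ true) (L.tabulate f)) ≡ count n (p ∘ f)
length-filter-tabulate {n = zero}  p f = refl
length-filter-tabulate {n = suc n} p f with p (f fz)
... | true  = cong suc (length-filter-tabulate p (f ∘ fs))
... | false = length-filter-tabulate p (f ∘ fs)

length-satisfiers : ∀ {n} (P : Fin n → Bool) → length (satisfiers P) ≡ count n P
length-satisfiers P = length-filter-tabulate P id

satisfiers-distinct : ∀ {n} (P : Fin n → Bool) → AllPairs _≢_ (satisfiers P)
satisfiers-distinct P = AllPairs.filter⁺ _ (AllPairs.tabulate⁺ id)

satisfiers-sound : ∀ {n} (P : Fin n → Bool) → All (λ i → P i ≡ true) (satisfiers P)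
satisfiers-sound {n} P = All.all-filter _ (L.allFin n)

Least : ∀ {n} → (Fin n → Bool) → Set
Least {n} P = Σ (Fin n) λ y → P y ≡ true × (∀ z → P z ≡ true → toℕ y ≤ toℕ z)

least? : ∀ {n} (P : Fin n → Bool) → Least P ⊎ (∀ z → P z ≡ false)
least? {zero}  P = inj₂ λ ()
least? {suc n} P with P fz in p0 | least? (P ∘ fs)
... | true  | _                     = inj₁ (fz , p0 , λ _ _ → z≤n)
... | false | inj₁ (y , py , y-min) = inj₁ (fs y , py , later)
  where
  later : ∀ z → P z ≡ true → toℕ (fs y) ≤ toℕ z
  later fz     pz = contradiction (trans (sym pz) p0) true≢false
  later (fs z) pz = s≤s (y-min z pz)
... | false | inj₂ none             = inj₂ λ { fz → p0 ; (fs z) → none z }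

least : ∀ {n} (P : Fin n → Bool) y → P y ≡ true → Least P
least P y py with least? P
... | inj₁ l    = l
... | inj₂ none = contradiction (trans (sym py) (none y)) true≢false

module _ {A : Set} (code : A → ℕ) where

  fibre : ℕ → List A → List A
  fibre c = filter (λ x → code x ≟ c)

  private
    kept : ∀ {P : A → Set} (P? : Decidable P) {x xs} → P x →
           length (filter P? (x ∷ xs)) ≡ suc (length (filter P? xs))
    kept P? px = cong length (filter-accept P? px)

    dropped : ∀ {P : A → Set} (P? : Decidable P) {x xs} → ¬ P x →
              length (filter P? (x ∷ xs)) ≡ length (filter P? xs)
    dropped P? ¬px = cong length (filter-reject P? ¬px)

    codeBelow : ℕ → List A → List A
    codeBelow k = filter (λ x → code x <? k)

    length-codeBelow-suc : ∀ k xs →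
      length (codeBelow (suc k) xs) ≤ length (fibre k xs) + length (codeBelow k xs)
    length-codeBelow-suc k [] = z≤n
    length-codeBelow-suc k (x ∷ xs) with ih ← length-codeBelow-suc k xs | <-cmp (code x) k
    ... | tri< x<k x≢k _ = begin
      length (codeBelow (suc k) (x ∷ xs))                  ≡⟨ kept (λ y → code y <? suc k) (m<n⇒m<1+n x<k) ⟩
      suc (length (codeBelow (suc k) xs))                  ≤⟨ s≤s ih ⟩
      suc (length (fibre k xs) + length (codeBelow k xs))  ≡⟨ sym (+-suc _ _) ⟩
      length (fibre k xs) + suc (length (codeBelow k xs))  ≡⟨ sym (cong₂ _+_ (dropped (λ y → code y ≟ k) x≢k)
                                                                       (kept (λ y → code y <? k) x<k)) ⟩
      length (fibre k (x ∷ xs)) + length (codeBelow k (x ∷ xs)) ∎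
      where open ≤-Reasoning
    ... | tri≈ x≮k x≡k _ = begin
      length (codeBelow (suc k) (x ∷ xs))                  ≡⟨ kept (λ y → code y <? suc k) (s≤s (≤-reflexive x≡k)) ⟩
      suc (length (codeBelow (suc k) xs))                  ≤⟨ s≤s ih ⟩
      suc (length (fibre k xs) + length (codeBelow k xs))  ≡⟨ sym (cong₂ _+_ (kept (λ y → code y ≟ k) x≡k)
                                                                       (dropped (λ y → code y <? k) x≮k)) ⟩
      length (fibre k (x ∷ xs)) + length (codeBelow k (x ∷ xs)) ∎
      where open ≤-Reasoning
    ... | tri> x≮k x≢k x>k = begin
      length (codeBelow (suc k) (x ∷ xs))                  ≡⟨ dropped (λ y → code y <? suc k) (<⇒≱ x>k ∘ ≤-pred) ⟩
      length (codeBelow (suc k) xs)                        ≤⟨ ih ⟩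
      length (fibre k xs) + length (codeBelow k xs)        ≡⟨ sym (cong₂ _+_ (dropped (λ y → code y ≟ k) x≢k)
                                                                       (dropped (λ y → code y <? k) x≮k)) ⟩
      length (fibre k (x ∷ xs)) + length (codeBelow k (x ∷ xs)) ∎
      where open ≤-Reasoning

  length≤fibres : ∀ k B xs → All (λ x → code x < k) xs →
                  (∀ c → c < k → length (fibre c xs) ≤ B) → length xs ≤ k * B
  length≤fibres k B xs codes<k fibre≤B = begin
    length xs                ≡⟨ cong length (sym (filter-all _ codes<k)) ⟩
    length (codeBelow k xs)  ≤⟨ codeBelow≤ k ≤-refl ⟩
    k * B                    ∎
    where
    open ≤-Reasoning
    codeBelow≤ : ∀ j → j ≤ k → length (codeBelow j xs) ≤ j * B
    codeBelow≤ zero    _   = ≤-reflexive (cong length (filter-none _ (All.universal (λ _ ()) xs)))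
    codeBelow≤ (suc j) j<k = ≤-trans (length-codeBelow-suc j xs)
                               (+-mono-≤ (fibre≤B j j<k) (codeBelow≤ j (<⇒≤ j<k)))

-- Orbits of a permutation

iter-+ : ∀ {A : Set} (g : A → A) a b x → iter g (a + b) x ≡ iter g a (iter g b x)
iter-+ g zero    b x = refl
iter-+ g (suc a) b x = cong g (iter-+ g a b x)

module Orbits {n} (π : Permutation′ n) where

  π^_ : ℕ → Fin n → Fin n
  π^_ = iter (π ⟨$⟩ʳ_)

  π^-+ : ∀ a b x → (π^ (a + b)) x ≡ (π^ a) ((π^ b) x)
  π^-+ = iter-+ (π ⟨$⟩ʳ_)

  π^-injective : ∀ t {x y} → (π^ t) x ≡ (π^ t) y → x ≡ y
  π^-injective zero    eq = eq
  π^-injective (suc t) eq =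
    π^-injective t (trans (sym (inverseˡ π)) (trans (cong (π ⟨$⟩ˡ_) eq) (inverseˡ π)))

  period : ∀ x → ∃ λ p → p < n × (π^ suc p) x ≡ x
  period x
    with i , j , i<j , πⁱx≡πʲx ← pigeonhole (n<1+n n) (λ (i : Fin (suc n)) → (π^ toℕ i) x)
    with p , 1+i+p≡j ← m≤n⇒∃[o]m+o≡n i<j
    = p , p<n , π^-injective (toℕ i) πⁱπᵖ⁺¹x≡πⁱx
    where
    p<n : p < n
    p<n = begin-strict
      p             <⟨ s≤s (m≤n+m p (toℕ i)) ⟩
      suc (toℕ i) + p ≡⟨ 1+i+p≡j ⟩
      toℕ j         ≤⟨ ≤-pred (toℕ<n j) ⟩
      n             ∎
      where open ≤-Reasoning
    πⁱπᵖ⁺¹x≡πⁱx : (π^ toℕ i) ((π^ suc p) x) ≡ (π^ toℕ i) x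
    πⁱπᵖ⁺¹x≡πⁱx = begin
      (π^ toℕ i) ((π^ suc p) x)   ≡⟨ sym (π^-+ (toℕ i) (suc p) x) ⟩
      (π^ (toℕ i + suc p)) x      ≡⟨ cong (λ m → (π^ m) x) (trans (+-suc (toℕ i) p) 1+i+p≡j) ⟩
      (π^ toℕ j) x                ≡⟨ sym πⁱx≡πʲx ⟩
      (π^ toℕ i) x                ∎
      where open ≡-Reasoning

  π^-periodic : ∀ {p x} → (π^ p) x ≡ x → ∀ q → (π^ (q * p)) x ≡ x
  π^-periodic         fix zero    = refl
  π^-periodic {p} {x} fix (suc q) = trans (π^-+ p (q * p) x) (trans (cong (π^ p) (π^-periodic fix q)) fix)

  π^-%-period : ∀ {p x} → (π^ suc p) x ≡ x → ∀ t → (π^ t) x ≡ (π^ (t % suc p)) x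
  π^-%-period {p} {x} fix t = begin
    (π^ t) x                                         ≡⟨ cong (λ m → (π^ m) x) (m≡m%n+[m/n]*n t (suc p)) ⟩
    (π^ (t % suc p + (t / suc p) * suc p)) x         ≡⟨ π^-+ (t % suc p) _ x ⟩
    (π^ (t % suc p)) ((π^ ((t / suc p) * suc p)) x)  ≡⟨ cong (π^ (t % suc p)) (π^-periodic fix (t / suc p)) ⟩
    (π^ (t % suc p)) x                               ∎
    where open ≡-Reasoning

  rewind : ∀ x a → ∃ λ t → (π^ t) ((π^ a) x) ≡ x
  rewind x a with p , _ , fix ← period x = a * p , (begin
    (π^ (a * p)) ((π^ a) x)  ≡⟨ sym (π^-+ (a * p) a x) ⟩
    (π^ (a * p + a)) x       ≡⟨ cong (λ m → (π^ m) x) (trans (+-comm (a * p) a) (sym (*-suc a p))) ⟩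
    (π^ (a * suc p)) x       ≡⟨ π^-periodic fix a ⟩
    x                        ∎)
    where open ≡-Reasoning

  π^-preserves : ∀ {R : Rel n} → Preserves π R → ∀ t x y → R ((π^ t) x) ((π^ t) y) ≡ R x y
  π^-preserves inv zero    x y = refl
  π^-preserves inv (suc t) x y = trans (inv ((π^ t) x) ((π^ t) y)) (π^-preserves inv t x y)

  visitsBelow : ℕ → Fin n → Bool
  visitsBelow b x = not (allL (λ t → b ≤ᵇ toℕ ((π^ t) x)) (upTo n))

  visitsBelow-intro : ∀ {b} x t → toℕ ((π^ t) x) < b → visitsBelow b x ≡ true
  visitsBelow-intro {b} x t πᵗx<b with p , p<n , fix ← period x =
    cong not (allL-applyUpTo-false _ id (<-≤-trans (m%n<n t (suc p)) p<n)
               (>⇒≤ᵇ-false (subst (λ y → toℕ y < b) (π^-%-period fix t) πᵗx<b)))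

  visitsBelow-elim : ∀ b x → visitsBelow b x ≡ true → ∃ λ t → toℕ ((π^ t) x) < b
  visitsBelow-elim b x h with t , _ , πᵗx≥b ← allL-applyUpTo-false⇒ _ id n (not-true⇒false h) =
    t , ≤ᵇ-false⇒> πᵗx≥b

  visitsBelow-π^ : ∀ b a x → visitsBelow b x ≡ true → visitsBelow b ((π^ a) x) ≡ true
  visitsBelow-π^ b a x h with t , πᵗx<b ← visitsBelow-elim b x h | s , πˢπᵃx≡x ← rewind x a =
    visitsBelow-intro ((π^ a) x) (t + s) (subst (λ y → toℕ y < b) eq πᵗx<b)
    where
    eq : (π^ t) x ≡ (π^ (t + s)) ((π^ a) x)
    eq = trans (cong (π^ t) (sym πˢπᵃx≡x)) (sym (π^-+ t s ((π^ a) x)))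

  visitsBelow-n : ∀ x → visitsBelow n x ≡ true
  visitsBelow-n x = visitsBelow-intro x 0 (toℕ<n x)

  visitsBelow-0 : ∀ x → visitsBelow 0 x ≡ false
  visitsBelow-0 x = cong not (allL-const-true (upTo n))

  visitsBelow-suc : ∀ {b} e → toℕ e ≡ b → ∀ x → visitsBelow (suc b) x ≡ true →
                    visitsBelow b x ≡ true ⊎ ∃ λ a → (π^ a) e ≡ x
  visitsBelow-suc {b} e e≡b x h with t , πᵗx<1+b ← visitsBelow-elim (suc b) x h | m≤n⇒m<n∨m≡n (≤-pred πᵗx<1+b)
  ... | inj₁ πᵗx<b = inj₁ (visitsBelow-intro x t πᵗx<b)
  ... | inj₂ πᵗx≡b with s , πˢπᵗx≡x ← rewind x t =
    inj₂ (s , trans (cong (π^ s) (toℕ-injective (trans e≡b (sym πᵗx≡b)))) πˢπᵗx≡x)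

module EquivalenceRelation {n} {R : Rel n} (E : IsEquivalence n R) where

  R-refl : ∀ x → R x x ≡ true
  R-refl = proj₁ E

  R-sym : ∀ x y → R x y ≡ R y x
  R-sym = proj₁ (proj₂ E)

  R-trans : ∀ {x y z} → R x y ≡ true → R y z ≡ true → R x z ≡ true
  R-trans {x} {y} {z} = proj₂ (proj₂ E) x y z

  R-sym-true : ∀ {x y} → R x y ≡ true → R y x ≡ true
  R-sym-true {x} {y} h = trans (R-sym y x) h

  R-respˡ : ∀ {x x'} y → R x x' ≡ true → R x y ≡ R x' y
  R-respˡ {x} {x'} y xRx' with R x y in xRy | R x' y in x'Ry
  ... | true  | true  = refl
  ... | false | false = refl
  ... | true  | false = contradiction (trans (sym (R-trans (R-sym-true xRx') xRy)) x'Ry) true≢false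
  ... | false | true  = contradiction (trans (sym (R-trans xRx' x'Ry)) xRy) true≢false

  R-respʳ : ∀ x {y y'} → R y y' ≡ true → R x y ≡ R x y'
  R-respʳ x {y} {y'} yRy' = trans (R-sym x y) (trans (R-respˡ x yRy') (R-sym y' x))

  cellMin : Fin n → Fin n
  cellMin x = proj₁ (least (R x) x (R-refl x))

  R-cellMin : ∀ x → R x (cellMin x) ≡ true
  R-cellMin x = proj₁ (proj₂ (least (R x) x (R-refl x)))

  isCellMin-cellMin : ∀ x → isCellMin R (cellMin x) ≡ true
  isCellMin-cellMin x = allᶠ-true _ below
    where
    minimal : ∀ y → R x y ≡ true → toℕ (cellMin x) ≤ toℕ y
    minimal = proj₂ (proj₂ (least (R x) x (R-refl x)))
    below : ∀ y → (not (R (cellMin x) y) ∨ (toℕ (cellMin x) ≤ᵇ toℕ y)) ≡ true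
    below y with R (cellMin x) y in cRy
    ... | false = refl
    ... | true  = ≤⇒≤ᵇ-true (minimal y (R-trans (R-cellMin x) cRy))

  unrelated⇒length≤numCells : ∀ {ys} → AllPairs (λ x y → R x y ≡ false) ys → length ys ≤ numCells R
  unrelated⇒length≤numCells {ys} unrelated = begin
    length ys                 ≡⟨ sym (length-map cellMin ys) ⟩
    length (L.map cellMin ys) ≤⟨ distinct⇒length≤count (isCellMin R) distinct
                                   (All.map⁺ (All.universal isCellMin-cellMin ys)) ⟩
    count n (isCellMin R)     ≡⟨ sym (countᵇ-allFin (isCellMin R)) ⟩
    numCells R                ∎
    where
    open ≤-Reasoning
    cells-differ : ∀ {x y} → R x y ≡ false → cellMin x ≢ cellMin y
    cells-differ {x} {y} xRy≡false eq =
      contradiction (trans (sym (R-trans (R-cellMin x) (subst (λ c → R c y ≡ true) (sym eq)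
                                    (R-sym-true (R-cellMin y))))) xRy≡false) true≢false
    distinct : AllPairs _≢_ (L.map cellMin ys)
    distinct = AllPairs.map⁺ (AllPairs.map cells-differ unrelated)

-- Adding one cycle

module NewCycle {n} (π : Permutation′ n) (old : Fin n → Bool)
                (old-π^ : ∀ a x → old x ≡ true → old ((Orbits.π^ π) a x) ≡ true) (e : Fin n) where

  open Orbits π

  oldCellMin : Rel n → Fin n → Bool
  oldCellMin R z = old z ∧ allᶠ n (λ w → not (old w ∧ R z w) ∨ (toℕ z ≤ᵇ toℕ w))

  oldCells : Rel n → ℕ
  oldCells R = count n (oldCellMin R)

  oldPartner : Rel n → Fin n → Bool
  oldPartner R y = old y ∧ R e y

  -- The index i stands for the return time i + 1, so the least return time is a least Fin n.
  returns : Rel n → Fin n → Bool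
  returns R i = R e ((π^ suc (toℕ i)) e)

  -- The last clause is junk: it is never reached when R is reflexive.
  codeWith : (R : Rel n) → Least (oldPartner R) ⊎ (∀ y → oldPartner R y ≡ false) →
             Least (returns R) ⊎ (∀ i → returns R i ≡ false) → ℕ
  codeWith R (inj₁ (r , _)) _              = rank (oldCellMin R) r
  codeWith R (inj₂ _)       (inj₁ (i , _)) = oldCells R + toℕ i
  codeWith R (inj₂ _)       (inj₂ _)       = 0

  code : Rel n → ℕ
  code R = codeWith R (least? (oldPartner R)) (least? (returns R))

  oldCellMin-elim : ∀ R {z} → oldCellMin R z ≡ true →
                    old z ≡ true × (∀ w → old w ≡ true → R z w ≡ true → toℕ z ≤ toℕ w)
  oldCellMin-elim R {z} h = ∧-conicalˡ _ _ h , below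
    where
    below : ∀ w → old w ≡ true → R z w ≡ true → toℕ z ≤ toℕ w
    below w oldw zRw = ≤ᵇ-true⇒≤ (subst (λ b → (not b ∨ (toℕ z ≤ᵇ toℕ w)) ≡ true)
                                   (cong₂ _∧_ oldw zRw) (allᶠ-true⇒ _ (∧-conicalʳ _ _ h) w))

  oldCellMin-intro : ∀ R {z} → old z ≡ true → (∀ w → old w ≡ true → R z w ≡ true → toℕ z ≤ toℕ w) →
                     oldCellMin R z ≡ true
  oldCellMin-intro R {z} oldz minimal rewrite oldz = allᶠ-true _ below
    where
    below : ∀ w → (not (old w ∧ R z w) ∨ (toℕ z ≤ᵇ toℕ w)) ≡ true
    below w with old w in oldw | R z w in zRw
    ... | false | _     = refl
    ... | true  | false = refl
    ... | true  | true  = ≤⇒≤ᵇ-true (minimal w oldw zRw)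

  old-code≢new-code : ∀ R {r} → oldCellMin R r ≡ true → ∀ i → rank (oldCellMin R) r ≢ oldCells R + i
  old-code≢new-code R h i = <⇒≢ (<-≤-trans (rank<count (oldCellMin R) h) (m≤m+n (oldCells R) i))

  module Invariant {R : Rel n} (E : IsEquivalence n R) (inv : Preserves π R) where

    open EquivalenceRelation E

    partner-oldCellMin : ((r , _) : Least (oldPartner R)) → oldCellMin R r ≡ true
    partner-oldCellMin (r , partner , minimal) =
      oldCellMin-intro R (∧-conicalˡ _ _ partner) λ w oldw rRw →
        minimal w (cong₂ _∧_ oldw (R-trans (∧-conicalʳ _ _ partner) rRw))

    oldCellMins-unrelated : ∀ {x y} → oldCellMin R x ≡ true → oldCellMin R y ≡ true → x ≢ y → R x y ≡ false
    oldCellMins-unrelated {x} {y} hx hy x≢y with R x y in xRy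
    ... | false = refl
    ... | true  = contradiction (toℕ-injective (≤-antisym
                    (proj₂ (oldCellMin-elim R hx) y (proj₁ (oldCellMin-elim R hy)) xRy)
                    (proj₂ (oldCellMin-elim R hy) x (proj₁ (oldCellMin-elim R hx)) (R-sym-true xRy)))) x≢y

    rotate : ∀ a b → R ((π^ a) e) ((π^ b) e) ≡ R e ((π^ (proj₁ (rewind e a) + b)) e)
    rotate a b = begin
      R ((π^ a) e) ((π^ b) e)              ≡⟨ sym (π^-preserves inv t ((π^ a) e) ((π^ b) e)) ⟩
      R ((π^ t) ((π^ a) e)) ((π^ t) ((π^ b) e)) ≡⟨ cong₂ R (proj₂ (rewind e a)) (sym (π^-+ t b e)) ⟩
      R e ((π^ (t + b)) e)                 ∎
      where
      open ≡-Reasoning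
      t : ℕ
      t = proj₁ (rewind e a)

    no-partner⇒orbit-unrelated : (∀ y → oldPartner R y ≡ false) →
                                 ∀ a y → old y ≡ true → R ((π^ a) e) y ≡ false
    no-partner⇒orbit-unrelated none a y oldy with t , πᵗπᵃe≡e ← rewind e a = begin
      R ((π^ a) e) y                  ≡⟨ sym (π^-preserves inv t ((π^ a) e) y) ⟩
      R ((π^ t) ((π^ a) e)) ((π^ t) y) ≡⟨ cong (λ z → R z ((π^ t) y)) πᵗπᵃe≡e ⟩
      R e ((π^ t) y)                  ≡⟨ subst (λ b → (b ∧ R e ((π^ t) y)) ≡ false)
                                           (old-π^ t y oldy) (none ((π^ t) y)) ⟩
      false                           ∎
      where open ≡-Reasoning

    returns-somewhere : ¬ (∀ i → returns R i ≡ false)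
    returns-somewhere never with p , p<n , fix ← period e =
      true≢false (trans (sym returnsAt-p) (never (fromℕ< p<n)))
      where
      returnsAt-p : returns R (fromℕ< p<n) ≡ true
      returnsAt-p = subst (λ m → R e ((π^ suc m) e) ≡ true) (sym (toℕ-fromℕ< p<n))
                          (trans (cong (R e) fix) (R-refl e))

    module ReturnTime (returnTime : Least (returns R)) where

      d : ℕ
      d = suc (toℕ (proj₁ returnTime))

      misses : ∀ {m} → 0 < m → m < d → R e ((π^ m) e) ≡ false
      misses {suc j} _ (s≤s j<i) with R e ((π^ suc j) e) in hit
      ... | false = refl
      ... | true  = contradiction i≤j (<⇒≱ j<i)
        where
        j<n : j < n
        j<n = <-trans j<i (toℕ<n (proj₁ returnTime))
        returnsAt-j : returns R (fromℕ< j<n) ≡ true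
        returnsAt-j = subst (λ m → R e ((π^ suc m) e) ≡ true) (sym (toℕ-fromℕ< j<n)) hit
        i≤j : toℕ (proj₁ returnTime) ≤ j
        i≤j = subst (_ ≤_) (toℕ-fromℕ< j<n) (proj₂ (proj₂ returnTime) (fromℕ< j<n) returnsAt-j)

      R-shift : ∀ m → R e ((π^ (d + m)) e) ≡ R e ((π^ m) e)
      R-shift m = begin
        R e ((π^ (d + m)) e)                 ≡⟨ cong (R e) (π^-+ d m e) ⟩
        R e ((π^ d) ((π^ m) e))              ≡⟨ R-respˡ _ (proj₁ (proj₂ returnTime)) ⟩
        R ((π^ d) e) ((π^ d) ((π^ m) e))     ≡⟨ π^-preserves inv d e ((π^ m) e) ⟩
        R e ((π^ m) e)                       ∎
        where open ≡-Reasoning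

      R-shift-multiple : ∀ q m → R e ((π^ (q * d + m)) e) ≡ R e ((π^ m) e)
      R-shift-multiple zero    m = refl
      R-shift-multiple (suc q) m =
        trans (cong (λ t → R e ((π^ t) e)) (+-assoc d (q * d) m))
              (trans (R-shift (q * d + m)) (R-shift-multiple q m))

      R-e-π^ : ∀ m → R e ((π^ m) e) ≡ (m % d ≡ᵇ 0)
      R-e-π^ m = trans (cong (λ t → R e ((π^ t) e)) m≡[m/d]*d+m%d)
                       (trans (R-shift-multiple (m / d) (m % d)) (by-remainder (m % d) (m%n<n m d)))
        where
        m≡[m/d]*d+m%d : m ≡ (m / d) * d + m % d
        m≡[m/d]*d+m%d = trans (m≡m%n+[m/n]*n m d) (+-comm (m % d) _)
        by-remainder : ∀ r → r < d → R e ((π^ r) e) ≡ (r ≡ᵇ 0)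
        by-remainder zero    _   = R-refl e
        by-remainder (suc r) r<d = misses z<s r<d

      orbit-unrelated : ∀ {a b} → a < b → b < d → R ((π^ a) e) ((π^ b) e) ≡ false
      orbit-unrelated {a} {b} a<b b<d = begin
        R ((π^ a) e) ((π^ b) e)               ≡⟨ cong (λ t → R ((π^ a) e) ((π^ t) e)) (sym (m+[n∸m]≡n (<⇒≤ a<b))) ⟩
        R ((π^ a) e) ((π^ (a + (b ∸ a))) e)   ≡⟨ cong (R ((π^ a) e)) (π^-+ a (b ∸ a) e) ⟩
        R ((π^ a) e) ((π^ a) ((π^ (b ∸ a)) e)) ≡⟨ π^-preserves inv a e ((π^ (b ∸ a)) e) ⟩
        R e ((π^ (b ∸ a)) e)                  ≡⟨ misses (m<n⇒0<n∸m a<b) (≤-<-trans (m∸n≤m b a) b<d) ⟩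
        false                                 ∎
        where open ≡-Reasoning

    oldCellMins-pairwise-unrelated : AllPairs (λ x y → R x y ≡ false) (satisfiers (oldCellMin R))
    oldCellMins-pairwise-unrelated =
      AllPairs-zipWith-All oldCellMins-unrelated (satisfiers-sound _) (satisfiers-distinct _)

    oldCells≤numCells : oldCells R ≤ numCells R
    oldCells≤numCells = begin
      oldCells R                            ≡⟨ sym (length-satisfiers (oldCellMin R)) ⟩
      length (satisfiers (oldCellMin R))    ≤⟨ unrelated⇒length≤numCells oldCellMins-pairwise-unrelated ⟩
      numCells R                            ∎
      where open ≤-Reasoning

    -- The old cells and the cells of e, π e, …, π^(d-1) e are pairwise distinct.
    oldCells+returnTime≤numCells : (∀ y → oldPartner R y ≡ false) → (ret : Least (returns R)) →
                                   oldCells R + ReturnTime.d ret ≤ numCells R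
    oldCells+returnTime≤numCells none ret = begin
      oldCells R + d                     ≡⟨ sym (cong₂ _+_ (length-satisfiers (oldCellMin R))
                                                         (length-applyUpTo (λ j → (π^ j) e) d)) ⟩
      length oldMins + length segment    ≡⟨ sym (length-++ oldMins) ⟩
      length (oldMins ++ segment)        ≤⟨ unrelated⇒length≤numCells
                                              (AllPairs.++⁺ oldCellMins-pairwise-unrelated
                                                (AllPairs.applyUpTo⁺₁ _ d orbit-unrelated)
                                                (All.map (λ {z} h → All.applyUpTo⁺₂ _ d (λ j → old⊥orbit j h))
                                                         (satisfiers-sound _))) ⟩
      numCells R                         ∎
      where
      open ≤-Reasoning
      open ReturnTime ret
      oldMins segment : List (Fin n)
      oldMins = satisfiers (oldCellMin R)
      segment = applyUpTo (λ j → (π^ j) e) d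
      old⊥orbit : ∀ {z} j → oldCellMin R z ≡ true → R z ((π^ j) e) ≡ false
      old⊥orbit {z} j h = trans (R-sym z _) (no-partner⇒orbit-unrelated none j z (proj₁ (oldCellMin-elim R h)))

    code<numCells : code R < numCells R
    code<numCells with least? (oldPartner R) | least? (returns R)
    ... | inj₁ partner | _         = <-≤-trans (rank<count (oldCellMin R) (partner-oldCellMin partner)) oldCells≤numCells
    ... | inj₂ none    | inj₁ ret  = <-≤-trans (+-monoʳ-< (oldCells R) (n<1+n _))
                                                (oldCells+returnTime≤numCells none ret)
    ... | inj₂ _       | inj₂ never = contradiction never returns-somewhere

  Extended : Fin n → Set
  Extended x = old x ≡ true ⊎ ∃ λ a → (π^ a) e ≡ x

  module Agreeing {R S : Rel n} (ER : IsEquivalence n R) (invR : Preserves π R)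
                  (ES : IsEquivalence n S) (invS : Preserves π S)
                  (agree : ∀ x y → old x ≡ true → old y ≡ true → R x y ≡ S x y) where

    module IR = Invariant ER invR
    module IS = Invariant ES invS
    module ER = EquivalenceRelation ER
    module ES = EquivalenceRelation ES

    oldCellMin-agree : ∀ z → oldCellMin R z ≡ oldCellMin S z
    oldCellMin-agree z with old z in oldz
    ... | false = refl
    ... | true  = allL-cong agree-at (L.allFin n)
      where
      agree-at : ∀ w → (not (old w ∧ R z w) ∨ (toℕ z ≤ᵇ toℕ w)) ≡ (not (old w ∧ S z w) ∨ (toℕ z ≤ᵇ toℕ w))
      agree-at w with old w in oldw
      ... | false = refl
      ... | true  = cong (λ b → not b ∨ (toℕ z ≤ᵇ toℕ w)) (agree z w oldz oldw)

    oldCells-agree : oldCells R ≡ oldCells S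
    oldCells-agree = count-cong oldCellMin-agree

    rank-agree : ∀ r → rank (oldCellMin R) r ≡ rank (oldCellMin S) r
    rank-agree r = count-cong (λ z → cong ((toℕ z <ᵇ toℕ r) ∧_) (oldCellMin-agree z))

    common-old-anchor : ∀ {r} → old r ≡ true → R e r ≡ true → S e r ≡ true →
                        ∀ z → Extended z → ∃ λ z' → old z' ≡ true × R z z' ≡ true × S z z' ≡ true
    common-old-anchor oldr eRr eSr z (inj₁ oldz)       = z , oldz , ER.R-refl z , ES.R-refl z
    common-old-anchor {r} oldr eRr eSr z (inj₂ (a , refl)) =
      (π^ a) r , old-π^ a r oldr , trans (π^-preserves invR a e r) eRr , trans (π^-preserves invS a e r) eSr

    agree-via-partner : ∀ {r} → old r ≡ true → R e r ≡ true → S e r ≡ true →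
                        ∀ x y → Extended x → Extended y → R x y ≡ S x y
    agree-via-partner oldr eRr eSr x y ext-x ext-y
      with x' , oldx' , xRx' , xSx' ← common-old-anchor oldr eRr eSr x ext-x
         | y' , oldy' , yRy' , ySy' ← common-old-anchor oldr eRr eSr y ext-y = begin
      R x y    ≡⟨ ER.R-respˡ y xRx' ⟩
      R x' y   ≡⟨ ER.R-respʳ x' yRy' ⟩
      R x' y'  ≡⟨ agree x' y' oldx' oldy' ⟩
      S x' y'  ≡⟨ sym (ES.R-respʳ x' ySy') ⟩
      S x' y   ≡⟨ sym (ES.R-respˡ y xSx') ⟩
      S x y    ∎
      where open ≡-Reasoning

    agree-via-return : (∀ y → oldPartner R y ≡ false) → (∀ y → oldPartner S y ≡ false) →
                       (retR : Least (returns R)) (retS : Least (returns S)) → proj₁ retR ≡ proj₁ retS →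
                       ∀ x y → Extended x → Extended y → R x y ≡ S x y
    agree-via-return noneR noneS retR retS i≡i' = go
      where
      orbit⊥old : ∀ a y → old y ≡ true → R ((π^ a) e) y ≡ S ((π^ a) e) y
      orbit⊥old a y oldy = trans (IR.no-partner⇒orbit-unrelated noneR a y oldy)
                                 (sym (IS.no-partner⇒orbit-unrelated noneS a y oldy))
      go : ∀ x y → Extended x → Extended y → R x y ≡ S x y
      go x y (inj₁ oldx) (inj₁ oldy) = agree x y oldx oldy
      go _ y (inj₂ (a , refl)) (inj₁ oldy) = orbit⊥old a y oldy
      go x _ (inj₁ oldx) (inj₂ (b , refl)) =
        trans (ER.R-sym x _) (trans (orbit⊥old b x oldx) (ES.R-sym _ x))
      go _ _ (inj₂ (a , refl)) (inj₂ (b , refl)) = begin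
        R ((π^ a) e) ((π^ b) e)                    ≡⟨ IR.rotate a b ⟩
        R e ((π^ m) e)                             ≡⟨ IR.ReturnTime.R-e-π^ retR m ⟩
        (m % suc (toℕ (proj₁ retR)) ≡ᵇ 0)         ≡⟨ cong (λ i → m % suc (toℕ i) ≡ᵇ 0) i≡i' ⟩
        (m % suc (toℕ (proj₁ retS)) ≡ᵇ 0)         ≡⟨ sym (IS.ReturnTime.R-e-π^ retS m) ⟩
        S e ((π^ m) e)                             ≡⟨ sym (IS.rotate a b) ⟩
        S ((π^ a) e) ((π^ b) e)                    ∎
        where
        open ≡-Reasoning
        m : ℕ
        m = proj₁ (rewind e a) + b

    code-injective : code R ≡ code S → ∀ x y → Extended x → Extended y → R x y ≡ S x y
    code-injective eq
      with least? (oldPartner R) | least? (oldPartner S) | least? (returns R) | least? (returns S)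
    ... | inj₁ (r , pR , minR) | inj₁ (r' , pS , minS) | _ | _
      with refl ← rank-injective (oldCellMin R) (IR.partner-oldCellMin (r , pR , minR))
                    (trans (oldCellMin-agree r') (IS.partner-oldCellMin (r' , pS , minS)))
                    (trans eq (sym (rank-agree r')))
      = agree-via-partner (∧-conicalˡ _ _ pR) (∧-conicalʳ _ _ pR) (∧-conicalʳ _ _ pS)
    ... | inj₁ partner | inj₂ _ | _ | inj₁ (i , _) =
      contradiction (trans eq (cong (_+ toℕ i) (sym oldCells-agree)))
                    (old-code≢new-code R (IR.partner-oldCellMin partner) (toℕ i))
    ... | inj₂ _ | inj₁ partner | inj₁ (i , _) | _ =
      contradiction (trans (sym eq) (cong (_+ toℕ i) oldCells-agree))
                    (old-code≢new-code S (IS.partner-oldCellMin partner) (toℕ i))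
    ... | inj₂ noneR | inj₂ noneS | inj₁ retR | inj₁ retS =
      agree-via-return noneR noneS retR retS
        (toℕ-injective (+-cancelˡ-≡ (oldCells R) _ _ (trans eq (cong (_+ toℕ (proj₁ retS)) (sym oldCells-agree)))))
    ... | _ | inj₂ _ | _ | inj₂ never = contradiction never IS.returns-somewhere
    ... | inj₂ _ | _ | inj₂ never | _ = contradiction never IR.returns-somewhere

-- Induction over the cycles

≤ᵇ-suc : ∀ {b v} → v ≢ b → (b ≤ᵇ v) ≡ (suc b ≤ᵇ v)
≤ᵇ-suc {b} {v} v≢b with <-cmp v b
... | tri< v<b _ _ = trans (>⇒≤ᵇ-false v<b) (sym (>⇒≤ᵇ-false (m<n⇒m<1+n v<b)))
... | tri≈ _ v≡b _ = contradiction v≡b v≢b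
... | tri> _ _ v>b = trans (≤⇒≤ᵇ-true (<⇒≤ v>b)) (sym (≤⇒≤ᵇ-true v>b))

module CycleInduction {n} (π : Permutation′ n) (k : ℕ) where

  open Orbits π

  Good : Rel n → Set
  Good R = IsEquivalence n R × numCells R ≤ k × Preserves π R

  AgreeBelow : ℕ → Rel n → Rel n → Set
  AgreeBelow b R S = ∀ x y → visitsBelow b x ≡ true → visitsBelow b y ≡ true → R x y ≡ S x y

  cyclesFrom : ℕ → ℕ
  cyclesFrom b = count n (λ i → (b ≤ᵇ toℕ i) ∧ isCycleMin π i)

  Bounded : ℕ → Set
  Bounded b = ∀ Rs → AllPairs Distinct Rs → All Good Rs → AllPairs (AgreeBelow b) Rs →
              length Rs ≤ k ^ cyclesFrom b

  bounded-n : Bounded n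
  bounded-n Rs distinct _ agree
    rewrite count-false {P = λ i → (n ≤ᵇ toℕ i) ∧ isCycleMin π i}
                        (λ i → cong (_∧ isCycleMin π i) (>⇒≤ᵇ-false (toℕ<n i))) = at-most-one Rs distinct agree
    where
    at-most-one : ∀ Rs → AllPairs Distinct Rs → AllPairs (AgreeBelow n) Rs → length Rs ≤ 1
    at-most-one []               _                               _                = z≤n
    at-most-one (_ ∷ [])         _                               _                = ≤-refl
    at-most-one (_ ∷ _ ∷ _) (((i , j , R≢S) ∷ _) ∷ _) ((R≈S ∷ _) ∷ _) =
      contradiction (R≈S i j (visitsBelow-n i) (visitsBelow-n j)) R≢S

  module _ {b} (e : Fin n) (e≡b : toℕ e ≡ b) where

    private
      cycleMinFrom-suc : ∀ i → i ≢ e →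
                         ((b ≤ᵇ toℕ i) ∧ isCycleMin π i) ≡ ((suc b ≤ᵇ toℕ i) ∧ isCycleMin π i)
      cycleMinFrom-suc i i≢e =
        cong (_∧ isCycleMin π i) (≤ᵇ-suc (λ i≡b → i≢e (toℕ-injective (trans i≡b (sym e≡b)))))

      b≤ᵇe : (b ≤ᵇ toℕ e) ≡ true
      b≤ᵇe = ≤⇒≤ᵇ-true (≤-reflexive (sym e≡b))

      1+b≰ᵇe : (suc b ≤ᵇ toℕ e) ≡ false
      1+b≰ᵇe = >⇒≤ᵇ-false (s≤s (≤-reflexive e≡b))

    cyclesFrom-not-min : isCycleMin π e ≡ false → cyclesFrom b ≡ cyclesFrom (suc b)
    cyclesFrom-not-min notMin = count-cong agree-at
      where
      agree-at : ∀ i → ((b ≤ᵇ toℕ i) ∧ isCycleMin π i) ≡ ((suc b ≤ᵇ toℕ i) ∧ isCycleMin π i)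
      agree-at i with i ≟ᶠ e
      ... | no i≢e  = cycleMinFrom-suc i i≢e
      ... | yes refl rewrite notMin = trans (∧-zeroʳ _) (sym (∧-zeroʳ _))

    cyclesFrom-min : isCycleMin π e ≡ true → cyclesFrom b ≡ suc (cyclesFrom (suc b))
    cyclesFrom-min isMin =
      count-except e cycleMinFrom-suc (cong₂ _∧_ b≤ᵇe isMin) (cong (_∧ isCycleMin π e) 1+b≰ᵇe)

    step-not-min : isCycleMin π e ≡ false → Bounded (suc b) → Bounded b
    step-not-min notMin IH Rs distinct good agree =
      subst (λ m → length Rs ≤ k ^ m) (sym (cyclesFrom-not-min notMin))
            (IH Rs distinct good (AllPairs.map widen agree))
      where
      e-visits : visitsBelow b e ≡ true
      e-visits = subst (λ m → visitsBelow m e ≡ true) e≡b (cong not notMin)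
      visits : ∀ x → visitsBelow (suc b) x ≡ true → visitsBelow b x ≡ true
      visits x h with visitsBelow-suc e e≡b x h
      ... | inj₁ x-visits   = x-visits
      ... | inj₂ (a , refl) = visitsBelow-π^ b a e e-visits
      widen : ∀ {R S} → AgreeBelow b R S → AgreeBelow (suc b) R S
      widen R≈S x y vx vy = R≈S x y (visits x vx) (visits y vy)

    step-min : isCycleMin π e ≡ true → Bounded (suc b) → Bounded b
    step-min isMin IH Rs distinct good agree = begin
      length Rs                   ≤⟨ length≤fibres code k (k ^ cyclesFrom (suc b)) Rs codes<k fibre-bound ⟩
      k * k ^ cyclesFrom (suc b)  ≡⟨ cong (k ^_) (sym (cyclesFrom-min isMin)) ⟩
      k ^ cyclesFrom b            ∎
      where
      open ≤-Reasoning
      open NewCycle π (visitsBelow b) (visitsBelow-π^ b) e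
      codes<k : All (λ R → code R < k) Rs
      codes<k = All.map (λ (E , cells≤k , inv) → <-≤-trans (Invariant.code<numCells E inv) cells≤k) good
      extended : ∀ x → visitsBelow (suc b) x ≡ true → Extended x
      extended = visitsBelow-suc e e≡b
      widen : ∀ {c R S} → Good R × code R ≡ c → Good S × code S ≡ c → AgreeBelow b R S → AgreeBelow (suc b) R S
      widen ((ER , _ , invR) , cR) ((ES , _ , invS) , cS) R≈S x y vx vy =
        Agreeing.code-injective ER invR ES invS R≈S (trans cR (sym cS)) x y (extended x vx) (extended y vy)
      fibre-bound : ∀ c → c < k → length (fibre code c Rs) ≤ k ^ cyclesFrom (suc b)
      fibre-bound c _ =
        IH (fibre code c Rs) (AllPairs.filter⁺ _ distinct) (All.filter⁺ _ good)
           (AllPairs-zipWith-All widen (All.zipWith id (All.filter⁺ _ good , All.all-filter _ Rs))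
                                       (AllPairs.filter⁺ _ agree))

  step : ∀ b → b < n → Bounded (suc b) → Bounded b
  step b b<n with isCycleMin π (fromℕ< b<n) in isMin?
  ... | true  = step-min     (fromℕ< b<n) (toℕ-fromℕ< b<n) isMin?
  ... | false = step-not-min (fromℕ< b<n) (toℕ-fromℕ< b<n) isMin?

  bounded : ∀ r b → r + b ≡ n → Bounded b
  bounded zero    b refl = bounded-n
  bounded (suc r) b r+1+b≡n =
    step b (≤-trans (s≤s (m≤n+m b r)) (≤-reflexive r+1+b≡n)) (bounded r (suc b) (trans (+-suc r b) r+1+b≡n))

lemma4p3 : (n k : ℕ) (k∣n : k ∣ n) (π : Permutation′ n)
           (Rs : List (Fin n → Fin n → Bool)) →
           AllPairs Distinct Rs →
           All (λ R → InX n k (_∣_.quotient k∣n) R × Preserves π R) Rs →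
           length Rs ≤ k ^ cycles π
lemma4p3 n k _ π Rs distinct inX = begin
  length Rs                   ≤⟨ bounded n 0 (+-identityʳ n) Rs distinct good agree ⟩
  k ^ count n (isCycleMin π)  ≡⟨ cong (k ^_) (sym (countᵇ-allFin (isCycleMin π))) ⟩
  k ^ cycles π                ∎
  where
  open ≤-Reasoning
  open CycleInduction π k
  open Orbits π
  good : All Good Rs
  good = All.map (λ ((E , cells≡k , _) , inv) → E , ≤-reflexive cells≡k , inv) inX
  agree : AllPairs (AgreeBelow 0) Rs
  agree = AllPairs.map (λ _ x _ visits _ → contradiction (trans (sym visits) (visitsBelow-0 x)) true≢false) distinct
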